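{- Let $G=(V,E)$ be an undirected graph and $s,a,b\in V$ with $a,b\ne s$ and $sa,sb\notin E$. Let $A=R_{sa}$ and $B=R_{sb}$, where $\kappa(s,a)\ge\kappa(s,b)$. Then one of the following holds: (i) $A\subseteq B$; (ii) $R_{as}\subsetneq B$ and $R_{bs}\subsetneq A$; (iii) $a\in\partial B$ or $b\in\partial A$.
   Context: $\kappa(x,y)$ is the maximum number of internally disjoint $xy$-paths in $G$. For $A\subseteq V$, $\partial A$ is the set of nodes outside $A$ having a neighbor in $A$, and $A^*=V\setminus(A\cup\partial A)$. $A$ is an $xy$-set if $x\in A$ and $y\in A^*$; $A$ is $xy$-tight if $A$ is an $xy$-set and $|\partial A|=\kappa(x,y)$. For distinct nonadjacent $x,y$, $R_{xy}$ denotes the unique inclusion-minimal $xy$-tight set (it exists and is unique since $xy$-tight sets are closed under intersection and union). -}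

module Defs where

open import Data.Nat using (ℕ; _≤_; suc)
open import Data.Bool using (Bool; true; false; not; _∧_)
open import Data.Fin using (Fin)
open import Data.Fin.Subset using (Subset; _∈_; _⊆_; ∣_∣)
open import Data.Vec using (tabulate; lookup)
open import Data.List using (List; _∷_; []; _++_; allFin)
open import Data.Bool.ListAction using (any)
import Data.List.Membership.Propositional as LM
open import Data.List.Relation.Unary.Unique.Propositional using (Unique)
open import Data.List.Relation.Unary.Linked using (Linked)
open import Data.Product using (Σ; _×_)
open import Relation.Binary.PropositionalEquality using (_≡_; _≢_)
open import Relation.Nullary using (¬_)

record Graph (n : ℕ) : Set where
  field
    adj    : Fin n → Fin n → Bool
    sym    : ∀ u v → adj u v ≡ adj v u
    irrefl : ∀ v → adj v v ≡ false

module _ {n : ℕ} (G : Graph n) where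
  open Graph G

  Adj : Fin n → Fin n → Set
  Adj u v = adj u v ≡ true

  -- An xy-path, given by its list of internal vertices: the vertex sequence
  -- x ∷ interior ++ [ y ] has no repeated vertex and consecutive vertices are adjacent.
  IsPath : Fin n → Fin n → List (Fin n) → Set
  IsPath x y int = Unique (x ∷ int ++ y ∷ []) × Linked Adj (x ∷ int ++ y ∷ [])

  HasDisjointPaths : Fin n → Fin n → ℕ → Set
  HasDisjointPaths x y k =
    Σ (Fin k → List (Fin n)) λ ps →
      (∀ i → IsPath x y (ps i)) ×
      (∀ i j → i ≢ j → ps i ≢ ps j) ×
      (∀ i j → i ≢ j → ∀ v → v LM.∈ ps i → ¬ (v LM.∈ ps j))

  IsKappa : Fin n → Fin n → ℕ → Set
  IsKappa x y k = HasDisjointPaths x y k × (∀ m → HasDisjointPaths x y m → m ≤ k)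

  ∂ : Subset n → Subset n
  ∂ A = tabulate λ v → not (lookup A v) ∧ any (λ u → adj u v ∧ lookup A u) (allFin n)

  _* : Subset n → Subset n
  A * = tabulate λ v → not (lookup A v) ∧ not (lookup (∂ A) v)

  IsXYSet : Fin n → Fin n → Subset n → Set
  IsXYSet x y A = x ∈ A × y ∈ A *

  IsTight : Fin n → Fin n → Subset n → Set
  IsTight x y A = IsXYSet x y A × Σ ℕ λ k → IsKappa x y k × ∣ ∂ A ∣ ≡ k

  -- R_xy : an inclusion-minimal xy-tight set (unique when x,y are distinct and nonadjacent).
  IsR : Fin n → Fin n → Subset n → Set
  IsR x y A = IsTight x y A × (∀ B → IsTight x y B → B ⊆ A → A ⊆ B)

module Submission where

-- The boundary size X ↦ |∂X| is submodular, and every xy-set X has |∂X| ≥ κ(x,y), since each of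
-- κ(x,y) disjoint xy-paths leaves X through its own vertex of ∂X. Hence if R = R_xy, x ∈ Y and
-- |∂Y| ≤ |∂(R ∪ Y)|, then R ∩ Y is again xy-tight, and minimality of R gives R ⊆ Y.
-- If b ∉ A ∪ ∂A, then A ∪ B is an sb-set; if a ∉ B ∪ ∂B, then A ∪ B is an sa-set and
-- κ(s,a) ≥ κ(s,b); either way A ⊆ B. Otherwise b ∈ A and a ∈ B: the principle applied to A and
-- R_as* gives A ⊆ R_as*, so b ∈ R_as*, and applied to R_as and B it gives R_as ⊆ B, strictly
-- because s ∈ B ∖ R_as. Symmetrically R_bs ⊊ A.

open import Defs
open import Data.Nat using (ℕ; zero; suc; _+_; _≤_; _≥_; z≤n; s≤s)
open import Data.Nat.Properties
  using (≤-trans; ≤-antisym; +-suc; +-mono-≤; +-monoʳ-≤; +-cancelʳ-≤)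
open import Data.Bool using (Bool; true; false; not; T)
open import Data.Bool.Properties using (T-∧; T-≡)
open import Data.Fin using (Fin; zero; suc)
open import Data.Fin.Properties using (suc-injective; 0≢1+n) renaming (_≟_ to _≟ᶠ_)
open import Data.Fin.Subset using (Subset; inside; outside; _∈_; _∉_; _⊆_; _⊂_; _∩_; _∪_; _-_; ∣_∣)
open import Data.Fin.Subset.Properties
  using (_∈?_; p⊆q⇒∣p∣≤∣q∣; p∩q⊆p; p∩q⊆q; x∈p∩q⁺; x∈p∩q⁻; x∈p∪q⁺; x∈p∪q⁻;
         x∈p∧x≢y⇒x∈p-y; x∈p⇒∣p-x∣<∣p∣)
open import Data.Vec using ([]; _∷_; lookup; tabulate)
open import Data.Vec.Properties using ([]=⇒lookup; lookup⇒[]=; lookup∘tabulate)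
open import Data.List using (List; []; _∷_; _++_; allFin)
open import Data.List.Relation.Unary.Any using (here; there; satisfied)
open import Data.List.Relation.Unary.Any.Properties using (any⁺; any⁻)
import Data.List.Membership.Propositional as List
open import Data.List.Membership.Propositional.Properties using (∈-allFin)
open import Data.List.Relation.Unary.Linked using (Linked; _∷_)
open import Data.Product using (∃; _×_; _,_; proj₁; proj₂)
open import Data.Sum using (_⊎_; inj₁; inj₂; [_,_])
open import Data.Empty using (⊥-elim)
open import Function using (_∘_)
open import Function.Bundles using (Equivalence)
open import Function.Definitions using (Injective)
open import Relation.Nullary using (¬_; yes; no)
open import Relation.Binary.PropositionalEquality
  using (_≡_; _≢_; refl; sym; trans; cong; subst; subst₂)

open Equivalence using (to; from)

∣p∩q∣+∣p∪q∣≡∣p∣+∣q∣ : ∀ {n} (p q : Subset n) → ∣ p ∩ q ∣ + ∣ p ∪ q ∣ ≡ ∣ p ∣ + ∣ q ∣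
∣p∩q∣+∣p∪q∣≡∣p∣+∣q∣ [] [] = refl
∣p∩q∣+∣p∪q∣≡∣p∣+∣q∣ (inside ∷ p) (inside ∷ q) =
  cong suc (trans (+-suc _ _) (trans (cong suc (∣p∩q∣+∣p∪q∣≡∣p∣+∣q∣ p q)) (sym (+-suc _ _))))
∣p∩q∣+∣p∪q∣≡∣p∣+∣q∣ (inside ∷ p) (outside ∷ q) =
  trans (+-suc _ _) (cong suc (∣p∩q∣+∣p∪q∣≡∣p∣+∣q∣ p q))
∣p∩q∣+∣p∪q∣≡∣p∣+∣q∣ (outside ∷ p) (inside ∷ q) =
  trans (+-suc _ _) (trans (cong suc (∣p∩q∣+∣p∪q∣≡∣p∣+∣q∣ p q)) (sym (+-suc _ _)))
∣p∩q∣+∣p∪q∣≡∣p∣+∣q∣ (outside ∷ p) (outside ∷ q) = ∣p∩q∣+∣p∪q∣≡∣p∣+∣q∣ p q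

∣p∣+∣q∣≤∣r∣+∣s∣ : ∀ {n} {p q r s : Subset n} →
  p ∩ q ⊆ r ∩ s → p ∪ q ⊆ r ∪ s → ∣ p ∣ + ∣ q ∣ ≤ ∣ r ∣ + ∣ s ∣
∣p∣+∣q∣≤∣r∣+∣s∣ {p = p} {q} {r} {s} ∩⊆ ∪⊆ =
  subst₂ _≤_ (∣p∩q∣+∣p∪q∣≡∣p∣+∣q∣ p q) (∣p∩q∣+∣p∪q∣≡∣p∣+∣q∣ r s)
    (+-mono-≤ (p⊆q⇒∣p∣≤∣q∣ ∩⊆) (p⊆q⇒∣p∣≤∣q∣ ∪⊆))

injective⇒≤∣p∣ : ∀ {n k} {p : Subset n} (f : Fin k → Fin n) →
  Injective _≡_ _≡_ f → (∀ i → f i ∈ p) → k ≤ ∣ p ∣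
injective⇒≤∣p∣ {k = zero} f f-inj f∈p = z≤n
injective⇒≤∣p∣ {k = suc k} {p} f f-inj f∈p =
  ≤-trans (s≤s (injective⇒≤∣p∣ (f ∘ suc) (suc-injective ∘ f-inj) f∘suc∈p-f0))
          (x∈p⇒∣p-x∣<∣p∣ (f∈p zero))
  where
  f∘suc∈p-f0 : ∀ i → f (suc i) ∈ p - f zero
  f∘suc∈p-f0 i = x∈p∧x≢y⇒x∈p-y (f∈p (suc i)) (λ eq → 0≢1+n (sym (f-inj eq)))

∈-tabulate⁺ : ∀ {n} {f : Fin n → Bool} {v} → T (f v) → v ∈ tabulate f
∈-tabulate⁺ {f = f} {v} t = lookup⇒[]= v _ (to T-≡ (subst T (sym (lookup∘tabulate f v)) t))

∈-tabulate⁻ : ∀ {n} {f : Fin n → Bool} {v} → v ∈ tabulate f → T (f v)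
∈-tabulate⁻ {f = f} {v} m = subst T (lookup∘tabulate f v) (from T-≡ ([]=⇒lookup m))

∉⇒T-not : ∀ {n} {p : Subset n} {v} → v ∉ p → T (not (lookup p v))
∉⇒T-not {p = p} {v} v∉p with lookup p v in eq
... | true  = ⊥-elim (v∉p (lookup⇒[]= v p eq))
... | false = _

T-not⇒∉ : ∀ {n} {p : Subset n} {v} → T (not (lookup p v)) → v ∉ p
T-not⇒∉ t v∈p = subst (T ∘ not) ([]=⇒lookup v∈p) t

module _ {n : ℕ} (G : Graph n) where
  infix 10 _⋆
  _⋆ : Subset n → Subset n
  X ⋆ = _* G X

  ∈∂⁺ : ∀ {X v u} → v ∉ X → Adj G u v → u ∈ X → v ∈ ∂ G X
  ∈∂⁺ {u = u} v∉X u~v u∈X = ∈-tabulate⁺ (from T-∧ (∉⇒T-not v∉X ,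
    any⁺ _ (List.lose (∈-allFin u) (from T-∧ (from T-≡ u~v , from T-≡ ([]=⇒lookup u∈X))))))

  ∈∂⁻ : ∀ X {v} → v ∈ ∂ G X → v ∉ X × ∃ λ u → Adj G u v × u ∈ X
  ∈∂⁻ X {v} v∈∂X with to T-∧ (∈-tabulate⁻ v∈∂X)
  ... | v∉X , has-neighbour with satisfied (any⁻ _ (allFin n) has-neighbour)
  ...   | u , u~v∧u∈X with to T-∧ u~v∧u∈X
  ...     | u~v , u∈X = T-not⇒∉ v∉X , u , to T-≡ u~v , lookup⇒[]= u X (to T-≡ u∈X)

  ∈⋆⁺ : ∀ {X v} → v ∉ X → v ∉ ∂ G X → v ∈ X ⋆
  ∈⋆⁺ v∉X v∉∂X = ∈-tabulate⁺ (from T-∧ (∉⇒T-not v∉X , ∉⇒T-not v∉∂X))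

  ∈⋆⁻ : ∀ X {v} → v ∈ X ⋆ → v ∉ X × v ∉ ∂ G X
  ∈⋆⁻ X v∈X⋆ with to T-∧ (∈-tabulate⁻ v∈X⋆)
  ... | v∉X , v∉∂X = T-not⇒∉ v∉X , T-not⇒∉ v∉∂X

  adj-sym : ∀ {u v} → Adj G u v → Adj G v u
  adj-sym {u} {v} u~v = trans (Graph.sym G v u) u~v

  no-edge-to-⋆ : ∀ {X u v} → u ∈ X → v ∈ X ⋆ → ¬ Adj G u v
  no-edge-to-⋆ {X} u∈X v∈X⋆ u~v = proj₂ (∈⋆⁻ X v∈X⋆) (∈∂⁺ (proj₁ (∈⋆⁻ X v∈X⋆)) u~v u∈X)

  ⋆-∪ : ∀ P Q {v} → v ∈ P ⋆ → v ∈ Q ⋆ → v ∈ (P ∪ Q) ⋆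
  ⋆-∪ P Q v∈P⋆ v∈Q⋆ =
    ∈⋆⁺ (λ v∈P∪Q → [ proj₁ (∈⋆⁻ P v∈P⋆) , proj₁ (∈⋆⁻ Q v∈Q⋆) ] (x∈p∪q⁻ P Q v∈P∪Q))
      λ v∈∂ → let (_ , u , u~v , u∈P∪Q) = ∈∂⁻ (P ∪ Q) v∈∂ in
        [ (λ u∈P → no-edge-to-⋆ u∈P v∈P⋆ u~v) , (λ u∈Q → no-edge-to-⋆ u∈Q v∈Q⋆ u~v) ]
          (x∈p∪q⁻ P Q u∈P∪Q)

  ⋆-antitone : ∀ {X Y} → X ⊆ Y → Y ⋆ ⊆ X ⋆
  ⋆-antitone {X} {Y} X⊆Y v∈Y⋆ = ∈⋆⁺ (proj₁ (∈⋆⁻ Y v∈Y⋆) ∘ X⊆Y)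
    λ v∈∂X → let (_ , u , u~v , u∈X) = ∈∂⁻ X v∈∂X in no-edge-to-⋆ (X⊆Y u∈X) v∈Y⋆ u~v

  ⊆⋆⋆ : ∀ {X} → X ⊆ X ⋆ ⋆
  ⊆⋆⋆ {X} v∈X = ∈⋆⁺ (λ v∈X⋆ → proj₁ (∈⋆⁻ X v∈X⋆) v∈X)
    λ v∈∂X⋆ → let (_ , u , u~v , u∈X⋆) = ∈∂⁻ (X ⋆) v∈∂X⋆ in no-edge-to-⋆ v∈X u∈X⋆ (adj-sym u~v)

  ∂⋆⊆∂ : ∀ X → ∂ G (X ⋆) ⊆ ∂ G X
  ∂⋆⊆∂ X {v} v∈∂X⋆ with ∈∂⁻ (X ⋆) v∈∂X⋆
  ... | v∉X⋆ , u , u~v , u∈X⋆ with v ∈? X | v ∈? ∂ G X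
  ...   | yes v∈X | _        = ⊥-elim (no-edge-to-⋆ v∈X u∈X⋆ (adj-sym u~v))
  ...   | no _    | yes v∈∂X = v∈∂X
  ...   | no v∉X  | no v∉∂X  = ⊥-elim (v∉X⋆ (∈⋆⁺ v∉X v∉∂X))

  ∂[P∩Q]⊆∂P∪∂Q : ∀ P Q → ∂ G (P ∩ Q) ⊆ ∂ G P ∪ ∂ G Q
  ∂[P∩Q]⊆∂P∪∂Q P Q {v} v∈∂ with ∈∂⁻ (P ∩ Q) v∈∂ | v ∈? P
  ... | v∉P∩Q , u , u~v , u∈P∩Q | yes v∈P =
    x∈p∪q⁺ (inj₂ (∈∂⁺ (λ v∈Q → v∉P∩Q (x∈p∩q⁺ (v∈P , v∈Q))) u~v (proj₂ (x∈p∩q⁻ P Q u∈P∩Q))))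
  ... | _ , u , u~v , u∈P∩Q | no v∉P =
    x∈p∪q⁺ (inj₁ (∈∂⁺ v∉P u~v (proj₁ (x∈p∩q⁻ P Q u∈P∩Q))))

  ∂[P∪Q]⊆∂P∪∂Q : ∀ P Q → ∂ G (P ∪ Q) ⊆ ∂ G P ∪ ∂ G Q
  ∂[P∪Q]⊆∂P∪∂Q P Q v∈∂ with ∈∂⁻ (P ∪ Q) v∈∂
  ... | v∉P∪Q , u , u~v , u∈P∪Q with x∈p∪q⁻ P Q u∈P∪Q
  ...   | inj₁ u∈P = x∈p∪q⁺ (inj₁ (∈∂⁺ (v∉P∪Q ∘ x∈p∪q⁺ ∘ inj₁) u~v u∈P))
  ...   | inj₂ u∈Q = x∈p∪q⁺ (inj₂ (∈∂⁺ (v∉P∪Q ∘ x∈p∪q⁺ ∘ inj₂) u~v u∈Q))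

  ∂[P∩Q]∩∂[P∪Q]⊆∂P∩∂Q : ∀ P Q → ∂ G (P ∩ Q) ∩ ∂ G (P ∪ Q) ⊆ ∂ G P ∩ ∂ G Q
  ∂[P∩Q]∩∂[P∪Q]⊆∂P∩∂Q P Q v∈ with x∈p∩q⁻ (∂ G (P ∩ Q)) (∂ G (P ∪ Q)) v∈
  ... | v∈∂[P∩Q] , v∈∂[P∪Q] with ∈∂⁻ (P ∩ Q) v∈∂[P∩Q] | ∈∂⁻ (P ∪ Q) v∈∂[P∪Q]
  ...   | _ , u , u~v , u∈P∩Q | v∉P∪Q , _ =
    x∈p∩q⁺ ( ∈∂⁺ (v∉P∪Q ∘ x∈p∪q⁺ ∘ inj₁) u~v (proj₁ (x∈p∩q⁻ P Q u∈P∩Q))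
           , ∈∂⁺ (v∉P∪Q ∘ x∈p∪q⁺ ∘ inj₂) u~v (proj₂ (x∈p∩q⁻ P Q u∈P∩Q)))

  ∣∂∣-submodular : ∀ P Q → ∣ ∂ G (P ∩ Q) ∣ + ∣ ∂ G (P ∪ Q) ∣ ≤ ∣ ∂ G P ∣ + ∣ ∂ G Q ∣
  ∣∂∣-submodular P Q = ∣p∣+∣q∣≤∣r∣+∣s∣ (∂[P∩Q]∩∂[P∪Q]⊆∂P∩∂Q P Q)
    λ v∈∪ → [ ∂[P∩Q]⊆∂P∪∂Q P Q , ∂[P∪Q]⊆∂P∪∂Q P Q ] (x∈p∪q⁻ (∂ G (P ∩ Q)) (∂ G (P ∪ Q)) v∈∪)

  path-meets-∂ : ∀ {X u y} (l : List (Fin n)) → u ∈ X → y ∈ X ⋆ →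
    Linked (Adj G) (u ∷ l ++ y ∷ []) → ∃ λ v → v List.∈ l × v ∈ ∂ G X
  path-meets-∂ []      u∈X y∈X⋆ (u~y ∷ _) = ⊥-elim (no-edge-to-⋆ u∈X y∈X⋆ u~y)
  path-meets-∂ {X} (w ∷ l) u∈X y∈X⋆ (u~w ∷ rest) with w ∈? X
  ... | yes w∈X = let (v , v∈l , v∈∂X) = path-meets-∂ l w∈X y∈X⋆ rest in v , there v∈l , v∈∂X
  ... | no w∉X  = w , here refl , ∈∂⁺ w∉X u~w u∈X

  disjointPaths≤∣∂∣ : ∀ {x y k X} → HasDisjointPaths G x y k → IsXYSet G x y X → k ≤ ∣ ∂ G X ∣
  disjointPaths≤∣∂∣ {k = k} {X} (ps , ps-paths , _ , ps-disjoint) (x∈X , y∈X⋆) =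
    injective⇒≤∣p∣ crossing crossing-injective (λ i → proj₂ (proj₂ (meet i)))
    where
    meet : ∀ i → ∃ λ v → v List.∈ ps i × v ∈ ∂ G X
    meet i = path-meets-∂ (ps i) x∈X y∈X⋆ (proj₂ (ps-paths i))
    crossing : Fin k → Fin n
    crossing i = proj₁ (meet i)
    crossing-injective : Injective _≡_ _≡_ crossing
    crossing-injective {i} {j} eq with i ≟ᶠ j
    ... | yes i≡j = i≡j
    ... | no i≢j  = ⊥-elim (ps-disjoint i j i≢j (crossing i) (proj₁ (proj₂ (meet i)))
                      (subst (List._∈ ps j) (sym eq) (proj₁ (proj₂ (meet j)))))

  tight-∣∂∣≡κ : ∀ {x y k A} → IsTight G x y A → IsKappa G x y k → ∣ ∂ G A ∣ ≡ k
  tight-∣∂∣≡κ (_ , _ , (paths , maximal) , ∣∂A∣≡k) (paths′ , maximal′) =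
    trans ∣∂A∣≡k (≤-antisym (maximal′ _ paths) (maximal _ paths′))

  tight-minimal : ∀ {x y A X} → IsTight G x y A → IsXYSet G x y X → ∣ ∂ G A ∣ ≤ ∣ ∂ G X ∣
  tight-minimal (_ , _ , (paths , _) , ∣∂A∣≡k) X-xy =
    subst (_≤ _) (sym ∣∂A∣≡k) (disjointPaths≤∣∂∣ paths X-xy)

  tight-minimal-reversed : ∀ {x y R X} → IsTight G y x R → IsXYSet G x y X → ∣ ∂ G R ∣ ≤ ∣ ∂ G X ∣
  tight-minimal-reversed {X = X} R-tight (x∈X , y∈X⋆) =
    ≤-trans (tight-minimal R-tight (y∈X⋆ , ⊆⋆⋆ x∈X)) (p⊆q⇒∣p∣≤∣q∣ (∂⋆⊆∂ X))

  ∪-xy-set : ∀ P Q {x y} → x ∈ P ⊎ x ∈ Q → y ∈ P ⋆ → y ∈ Q ⋆ → IsXYSet G x y (P ∪ Q)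
  ∪-xy-set P Q x∈P⊎Q y∈P⋆ y∈Q⋆ = x∈p∪q⁺ x∈P⊎Q , ⋆-∪ P Q y∈P⋆ y∈Q⋆

  ∣∂Y∣≤∣∂[R∪Y]∣⇒R⊆Y : ∀ {x y R Y} → IsR G x y R → x ∈ Y → ∣ ∂ G Y ∣ ≤ ∣ ∂ G (R ∪ Y) ∣ → R ⊆ Y
  ∣∂Y∣≤∣∂[R∪Y]∣⇒R⊆Y {R = R} {Y} (R-tight@((x∈R , y∈R⋆) , k , κ , ∣∂R∣≡k) , R-minimal) x∈Y ∣∂Y∣≤ =
    p∩q⊆q R Y ∘ R-minimal (R ∩ Y) R∩Y-tight (p∩q⊆p R Y)
    where
    R∩Y-xy : IsXYSet G _ _ (R ∩ Y)
    R∩Y-xy = x∈p∩q⁺ (x∈R , x∈Y) , ⋆-antitone (p∩q⊆p R Y) y∈R⋆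
    ∣∂[R∩Y]∣≤∣∂R∣ : ∣ ∂ G (R ∩ Y) ∣ ≤ ∣ ∂ G R ∣
    ∣∂[R∩Y]∣≤∣∂R∣ = +-cancelʳ-≤ _ _ _
      (≤-trans (∣∂∣-submodular R Y) (+-monoʳ-≤ (∣ ∂ G R ∣) ∣∂Y∣≤))
    R∩Y-tight : IsTight G _ _ (R ∩ Y)
    R∩Y-tight = R∩Y-xy , k , κ ,
      trans (≤-antisym ∣∂[R∩Y]∣≤∣∂R∣ (tight-minimal R-tight R∩Y-xy)) ∣∂R∣≡k

  R-reversed⊂ : ∀ {x y z A B R} → IsR G x y A → IsTight G x z B → IsR G y x R →
    y ∈ B → z ∈ A → R ⊂ B
  R-reversed⊂ {A = A} {B} {R}
    isA@(((x∈A , y∈A⋆) , _) , _) B-tight@((x∈B , z∈B⋆) , _)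
    isR@(R-tight@((y∈R , x∈R⋆) , _) , _) y∈B z∈A =
    R⊆B , _ , x∈B , proj₁ (∈⋆⁻ R x∈R⋆)
    where
    A⊆R⋆ : A ⊆ R ⋆
    A⊆R⋆ = ∣∂Y∣≤∣∂[R∪Y]∣⇒R⊆Y isA x∈R⋆ (≤-trans (p⊆q⇒∣p∣≤∣q∣ (∂⋆⊆∂ R))
      (tight-minimal-reversed R-tight (∪-xy-set A (R ⋆) (inj₁ x∈A) y∈A⋆ (⊆⋆⋆ y∈R))))
    R⊆B : R ⊆ B
    R⊆B = ∣∂Y∣≤∣∂[R∪Y]∣⇒R⊆Y isR y∈B
      (tight-minimal B-tight (∪-xy-set R B (inj₂ x∈B) (A⊆R⋆ z∈A) z∈B⋆))

-- The hypotheses a ≢ s, b ≢ s and the non-adjacency of s to a and b only guarantee that the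
-- sets R exist; here those sets are given.
corollary1 : (n : ℕ) (G : Graph n) (s a b : Fin n) →
    a ≢ s → b ≢ s →
    Graph.adj G s a ≡ false → Graph.adj G s b ≡ false →
    (A B Ras Rbs : Subset n) →
    IsR G s a A → IsR G s b B → IsR G a s Ras → IsR G b s Rbs →
    (ka kb : ℕ) → IsKappa G s a ka → IsKappa G s b kb → ka ≥ kb →
    (A ⊆ B) ⊎ ((Ras ⊂ B × Rbs ⊂ A) ⊎ (a ∈ ∂ G B ⊎ b ∈ ∂ G A))
corollary1 _ G s a b _ _ _ _ A B Ras Rbs
  isA@(A-tight@((s∈A , a∈A⋆) , _) , _) isB@(B-tight@((s∈B , b∈B⋆) , _) , _) isRas isRbs
  _ _ κa κb kb≤ka
  with a ∈? ∂ G B | b ∈? ∂ G A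
... | yes a∈∂B | _        = inj₂ (inj₂ (inj₁ a∈∂B))
... | no _     | yes b∈∂A = inj₂ (inj₂ (inj₂ b∈∂A))
... | no a∉∂B  | no b∉∂A with b ∈? A | a ∈? B
...   | yes b∈A | yes a∈B =
  inj₂ (inj₁ (R-reversed⊂ G isA B-tight isRas a∈B b∈A , R-reversed⊂ G isB A-tight isRbs b∈A a∈B))
...   | no b∉A  | _       =
  inj₁ (∣∂Y∣≤∣∂[R∪Y]∣⇒R⊆Y G isA s∈B
    (tight-minimal G B-tight (∪-xy-set G A B (inj₁ s∈A) (∈⋆⁺ G b∉A b∉∂A) b∈B⋆)))
...   | yes _   | no a∉B  =
  inj₁ (∣∂Y∣≤∣∂[R∪Y]∣⇒R⊆Y G isA s∈B (≤-trans ∣∂B∣≤∣∂A∣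
    (tight-minimal G A-tight (∪-xy-set G A B (inj₁ s∈A) a∈A⋆ (∈⋆⁺ G a∉B a∉∂B)))))
  where
  ∣∂B∣≤∣∂A∣ : ∣ ∂ G B ∣ ≤ ∣ ∂ G A ∣
  ∣∂B∣≤∣∂A∣ = subst₂ _≤_ (sym (tight-∣∂∣≡κ G B-tight κb)) (sym (tight-∣∂∣≡κ G A-tight κa)) kb≤ka
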